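{- For all $n\geq1$, the number of Dyck paths with air pockets (of any length) having exactly $n$ up-steps $U$ and no down-step $D_1$ is the Riordan number $\sum_{k=0}^n(-1)^{n-k}\binom{n}{k}c_k$, where $c_k=\frac{1}{k+1}\binom{2k}{k}$.
   Context: A Dyck path with air pockets is a non-empty lattice path in the first quadrant of $\mathbb{Z}^2$ starting at the origin, ending on the $x$-axis, consisting of up-steps $U=(1,1)$ and down-steps $D_k=(1,-k)$, $k\geq1$, where no two down-steps are consecutive. -}

module Defs where

open import Data.Nat using (ℕ; zero; suc; _+_; _*_; _/_; _≤_)
open import Data.Nat.Combinatorics using (_C_)
open import Data.Integer as ℤ using (ℤ; +_)
open import Data.List using (List; []; _∷_; upTo; map; sum)
open import Data.List.Membership.Propositional using (_∈_)
open import Data.List.Relation.Unary.Unique.Propositional using (Unique)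
open import Data.Product using (_×_; Σ; ∃)
open import Data.Empty using (⊥)
open import Data.Unit using (⊤)
open import Function.Bundles using (_⇔_)
open import Relation.Binary.PropositionalEquality using (_≡_)

-- A step: U = (1,1), or D k = (1, -(k+1)), i.e. "D k" encodes D_{k+1}, so
-- every down-step has size ≥ 1 by construction.
data Step : Set where
  U : Step
  D : ℕ → Step

StaysAndEnds : ℕ → List Step → Set
StaysAndEnds h []           = h ≡ 0
StaysAndEnds h (U ∷ s)      = StaysAndEnds (suc h) s
StaysAndEnds h (D k ∷ s)    = Σ (suc k ≤ h) λ _ → StaysAndEnds (h Data.Nat.∸ suc k) s

NoDD : List Step → Set
NoDD []              = ⊤
NoDD (U ∷ s)         = NoDD s
NoDD (D _ ∷ [])      = ⊤
NoDD (D _ ∷ U ∷ s)   = NoDD (U ∷ s)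
NoDD (D _ ∷ D _ ∷ s) = ⊥

NonEmpty : List Step → Set
NonEmpty []      = ⊥
NonEmpty (_ ∷ _) = ⊤

IsDAP : List Step → Set
IsDAP s = NonEmpty s × StaysAndEnds 0 s × NoDD s

ups : List Step → ℕ
ups []        = 0
ups (U ∷ s)   = suc (ups s)
ups (D _ ∷ s) = ups s

-- No down-step D_1 (D_1 is encoded as D 0).
NoD1 : List Step → Set
NoD1 []            = ⊤
NoD1 (U ∷ s)       = NoD1 s
NoD1 (D zero ∷ s)  = ⊥
NoD1 (D (suc _) ∷ s) = NoD1 s

-- "the number of p with property P is m": a duplicate-free list enumerating
-- exactly the p with P, of length m.
HasCount : {A : Set} → (A → Set) → ℕ → Set
HasCount {A} P m = Σ (List A) λ xs →
  Unique xs × ((x : A) → (x ∈ xs ⇔ P x)) × Data.List.length xs ≡ m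

-- Catalan number c_k = binom(2k,k)/(k+1)  (exact division).
catalan : ℕ → ℕ
catalan k = ((2 * k) C k) / suc k

sgn : ℕ → ℤ
sgn zero          = + 1
sgn (suc zero)    = ℤ.- (+ 1)
sgn (suc (suc j)) = sgn j

riordan : ℕ → ℤ
riordan n = Data.List.foldr ℤ._+_ (+ 0)
  (map (λ k → sgn (n Data.Nat.∸ k) ℤ.* (+ ((n C k) * catalan k))) (upTo (suc n)))

module Submission where

-- A D₁-free path with air pockets from height h is empty, starts with U, or starts with
-- some D_k, 2 ≤ k ≤ h, followed by a path that does not start with a down-step.  Let
-- b_h(m) count the U/D₁-paths from height h − 1 to the axis with m up-steps (b_0 = 0).
-- Then the paths from height h with u up-steps not starting with a down-step number
-- Δᵘ(b_{h+1} − b_h)(0): both sides obey the same recursion in u, since the sum over k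
-- telescopes and the ballot recursion b_{h+1}(m + 1) = b_{h+2}(m) + b_h(m + 1) trades Δ
-- for a shift in h.  At h = 0 the count is Δⁿ c (0) with c_m = b_1(m) the Catalan
-- numbers, and Newton's forward difference formula expands this into the Riordan sum.

open import Defs
open import Data.Nat as ℕ using (ℕ; zero; suc; _+_; _*_; _∸_; _≤_; _<_; _≥_; s≤s)
import Data.Nat.Properties as ℕ
open import Data.Nat.Combinatorics using (_C_; k>n⇒nCk≡0; nC1≡n; nCk≡nC[n∸k]; nCk+nC[k+1]≡[n+1]C[k+1])
open import Data.Nat.DivMod using (m*n/n≡m)
import Data.Nat.Tactic.RingSolver as ℕ-Solver
open import Data.Integer as ℤ using (ℤ; +_)
import Data.Integer.Properties as ℤ
import Data.Integer.Tactic.RingSolver as ℤ-Solver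
open import Data.List using (List; []; _∷_; _++_; length; foldr; map; applyUpTo)
open import Data.List.Properties using (length-map; length-++; ∷-injectiveˡ; ∷-injectiveʳ)
open import Data.List.Membership.Propositional using (_∈_)
open import Data.List.Membership.Propositional.Properties using (∈-map⁺; ∈-map⁻; ∈-++⁺ˡ; ∈-++⁺ʳ; ∈-++⁻)
open import Data.List.Relation.Unary.Any using (here)
open import Data.List.Relation.Unary.Unique.Propositional using (Unique)
open import Data.List.Relation.Unary.Unique.Propositional.Properties using (map⁺; ++⁺)
import Data.List.Relation.Unary.AllPairs as AllPairs
import Data.List.Relation.Unary.All as All
open import Data.Product using (_×_; _,_; proj₁; proj₂; ∃)
open import Function.Bundles using (_⇔_; mk⇔)
open import Data.Sum using ([_,_]′)
open import Data.Unit using (⊤; tt)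
open import Data.Empty using (⊥)
open import Function using (_∘_)
open import Relation.Nullary using (¬_; Dec; yes; no)
open import Relation.Binary.PropositionalEquality
open ≡-Reasoning
open import Algebra.Properties.CommutativeSemigroup ℕ.+-commutativeSemigroup using (interchange)

pascal : ∀ n k → suc n C suc k ≡ n C k + n C suc k
pascal n k = sym (nCk+nC[k+1]≡[n+1]C[k+1] n k)

-- (k + 1) C(n, k + 1) = (n − k) C(n, k), stated without truncated subtraction.
absorption : ∀ n k → suc k * (n C suc k) + k * (n C k) ≡ n * (n C k)
absorption n zero = begin
  1 * (n C 1) + 0 ≡⟨ cong (λ c → 1 * c + 0) (nC1≡n n) ⟩
  1 * n + 0       ≡⟨ 1*n+0≡n*1 n ⟩
  n * 1           ∎
  where
  1*n+0≡n*1 : ∀ n → 1 * n + 0 ≡ n * 1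
  1*n+0≡n*1 = ℕ-Solver.solve-∀
absorption zero (suc k) = cong₂ _+_ (ℕ.*-zeroʳ (suc (suc k))) (ℕ.*-zeroʳ (suc k))
absorption (suc n) (suc k) = begin
  suc (suc k) * (suc n C suc (suc k)) + suc k * (suc n C suc k)
    ≡⟨ cong₂ (λ x y → suc (suc k) * x + suc k * y) (pascal n (suc k)) (pascal n k) ⟩
  suc (suc k) * (b + c) + suc k * (a + b)
    ≡⟨ expand k a b c ⟩
  (suc (suc k) * c + suc k * b) + (suc k * b + k * a) + a + b
    ≡⟨ cong₂ (λ x y → x + y + a + b) (absorption n (suc k)) (absorption n k) ⟩
  n * b + n * a + a + b
    ≡⟨ collect n a b ⟩
  suc n * (a + b)
    ≡⟨ cong (suc n *_) (pascal n k) ⟨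
  suc n * (suc n C suc k) ∎
  where
  a = n C k
  b = n C suc k
  c = n C suc (suc k)
  expand : ∀ k a b c → suc (suc k) * (b + c) + suc k * (a + b)
                     ≡ (suc (suc k) * c + suc k * b) + (suc k * b + k * a) + a + b
  expand = ℕ-Solver.solve-∀
  collect : ∀ n a b → n * b + n * a + a + b ≡ suc n * (a + b)
  collect = ℕ-Solver.solve-∀

middle-symmetry : ∀ m → suc (2 * m) C suc m ≡ suc (2 * m) C m
middle-symmetry m = subst (λ n → n C suc m ≡ n C m) (double m) (begin
  (suc m + m) C suc m             ≡⟨ cong ((suc m + m) C_) (ℕ.m+n∸n≡m (suc m) m) ⟨
  (suc m + m) C (suc m + m ∸ m)   ≡⟨ nCk≡nC[n∸k] (ℕ.m≤n+m m (suc m)) ⟨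
  (suc m + m) C m                 ∎)
  where
  double : ∀ m → suc m + m ≡ suc (2 * m)
  double = ℕ-Solver.solve-∀

-- ballot h m counts the U/D₁-paths from height h down to the x-axis with m up-steps.
ballot : ℕ → ℕ → ℕ
ballot h       zero    = 1
ballot zero    (suc m) = ballot 1 m
ballot (suc h) (suc m) = ballot (suc (suc h)) m + ballot h (suc m)

-- The reflection principle; a ballot path from height h with m up-steps has h + 2m steps.
ballot-reflection : ∀ h m → ballot h (suc m) + (h + 2 * suc m) C m ≡ (h + 2 * suc m) C suc m
ballot-reflection zero    zero    = refl
ballot-reflection zero    (suc m) = begin
  ballot 1 (suc m) + N C suc m          ≡⟨ cong (λ n → ballot 1 (suc m) + n C suc m) (N≡1+N′ m) ⟩
  ballot 1 (suc m) + suc N′ C suc m     ≡⟨ cong (_+_ (ballot 1 (suc m))) (pascal N′ m) ⟩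
  ballot 1 (suc m) + (N′ C m + N′ C suc m)
    ≡⟨ ℕ.+-assoc (ballot 1 (suc m)) _ _ ⟨
  ballot 1 (suc m) + N′ C m + N′ C suc m
    ≡⟨ cong₂ _+_ (ballot-reflection 1 m) (sym (middle-symmetry (suc m))) ⟩
  N′ C suc m + N′ C suc (suc m)         ≡⟨ pascal N′ (suc m) ⟨
  suc N′ C suc (suc m)                  ≡⟨ cong (_C suc (suc m)) (N≡1+N′ m) ⟨
  N C suc (suc m)                       ∎
  where
  N = 2 * suc (suc m)
  N′ = 1 + 2 * suc m
  N≡1+N′ : ∀ m → 2 * suc (suc m) ≡ suc (1 + 2 * suc m)
  N≡1+N′ = ℕ-Solver.solve-∀
ballot-reflection (suc h) zero    =
  trans (cong suc (ballot-reflection h zero)) (sym (pascal (h + 2 * 1) 0))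
ballot-reflection (suc h) (suc m) = begin
  (ballot (2 + h) (suc m) + ballot h (2 + m)) + suc N C suc m
    ≡⟨ cong (_+_ (ballot (2 + h) (suc m) + ballot h (2 + m))) (pascal N m) ⟩
  (ballot (2 + h) (suc m) + ballot h (2 + m)) + (N C m + N C suc m)
    ≡⟨ interchange (ballot (2 + h) (suc m)) _ _ _ ⟩
  (ballot (2 + h) (suc m) + N C m) + (ballot h (2 + m) + N C suc m)
    ≡⟨ cong₂ _+_ reflection-from-2+h (ballot-reflection h (suc m)) ⟩
  N C suc m + N C suc (suc m)
    ≡⟨ pascal N (suc m) ⟨
  suc N C suc (suc m) ∎
  where
  N = h + 2 * suc (suc m)
  N≡N′ : ∀ h m → h + 2 * suc (suc m) ≡ 2 + h + 2 * suc m
  N≡N′ = ℕ-Solver.solve-∀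
  reflection-from-2+h : ballot (2 + h) (suc m) + N C m ≡ N C suc m
  reflection-from-2+h = subst (λ n → ballot (2 + h) (suc m) + n C m ≡ n C suc m)
                              (sym (N≡N′ h m)) (ballot-reflection (2 + h) m)

ballot0k*[1+k]≡[2k]Ck : ∀ k → ballot 0 k * suc k ≡ (2 * k) C k
ballot0k*[1+k]≡[2k]Ck zero    = refl
ballot0k*[1+k]≡[2k]Ck (suc m) = ℕ.+-cancelʳ-≡ (suc (suc m) * Y) _ _ (begin
  b * suc (suc m) + suc (suc m) * Y  ≡⟨ factor b Y m ⟩
  suc (suc m) * (b + Y)              ≡⟨ cong (suc (suc m) *_) (ballot-reflection 0 m) ⟩
  suc (suc m) * X                    ≡⟨ cong (_+_ X) (ℕ.+-cancelʳ-≡ (m * Y) _ _ absorbed) ⟩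
  X + suc (suc m) * Y                ∎)
  where
  N = 2 * suc m
  X = N C suc m
  Y = N C m
  b = ballot 0 (suc m)
  absorbed : suc m * X + m * Y ≡ suc (suc m) * Y + m * Y
  absorbed = trans (absorption N m) (split m Y)
    where
    split : ∀ m Y → 2 * suc m * Y ≡ suc (suc m) * Y + m * Y
    split = ℕ-Solver.solve-∀
  factor : ∀ b Y m → b * suc (suc m) + suc (suc m) * Y ≡ suc (suc m) * (b + Y)
  factor = ℕ-Solver.solve-∀

catalan≡ballot : ∀ k → catalan k ≡ ballot 0 k
catalan≡ballot k = trans (cong (ℕ._/ suc k) (sym (ballot0k*[1+k]≡[2k]Ck k))) (m*n/n≡m (ballot 0 k) (suc k))

sgn-suc : ∀ j → sgn (suc j) ≡ ℤ.- sgn j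
sgn-suc zero    = refl
sgn-suc (suc j) = trans (sym (ℤ.neg-involutive (sgn j))) (cong ℤ.-_ (sym (sgn-suc j)))

sgn-∸-suc : ∀ {n k} → k < n → sgn (n ∸ k) ≡ ℤ.- sgn (n ∸ suc k)
sgn-∸-suc {suc n} {zero}  _         = sgn-suc n
sgn-∸-suc {suc n} {suc k} (s≤s k<n) = sgn-∸-suc k<n

signedBinomial : ℕ → ℕ → ℤ
signedBinomial n k = sgn (n ∸ k) ℤ.* + (n C k)

signedBinomial-suc-zero : ∀ n → signedBinomial (suc n) 0 ≡ ℤ.- signedBinomial n 0
signedBinomial-suc-zero n = trans (cong (ℤ._* + 1) (sgn-suc n)) (sym (ℤ.neg-distribˡ-* (sgn n) (+ 1)))

signedBinomial-suc-suc : ∀ n k →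
  signedBinomial (suc n) (suc k) ≡ signedBinomial n k ℤ.- signedBinomial n (suc k)
signedBinomial-suc-suc n k = begin
  sgn (n ∸ k) ℤ.* + (suc n C suc k)
    ≡⟨ cong (λ c → sgn (n ∸ k) ℤ.* + c) (pascal n k) ⟩
  sgn (n ∸ k) ℤ.* (+ (n C k) ℤ.+ + (n C suc k))
    ≡⟨ ℤ.*-distribˡ-+ (sgn (n ∸ k)) (+ (n C k)) _ ⟩
  signedBinomial n k ℤ.+ sgn (n ∸ k) ℤ.* + (n C suc k)
    ≡⟨ cong (ℤ._+_ (signedBinomial n k)) (sign-flip (k ℕ.<? n)) ⟩
  signedBinomial n k ℤ.- signedBinomial n (suc k) ∎
  where
  sign-flip : Dec (k < n) → sgn (n ∸ k) ℤ.* + (n C suc k) ≡ ℤ.- signedBinomial n (suc k)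
  sign-flip (yes k<n) = trans (cong (ℤ._* + (n C suc k)) (sgn-∸-suc k<n))
                              (sym (ℤ.neg-distribˡ-* (sgn (n ∸ suc k)) _))
  sign-flip (no k≮n)  = begin
    sgn (n ∸ k) ℤ.* + (n C suc k)       ≡⟨ cong (λ c → sgn (n ∸ k) ℤ.* + c) nC[1+k]≡0 ⟩
    sgn (n ∸ k) ℤ.* + 0                 ≡⟨ ℤ.*-zeroʳ (sgn (n ∸ k)) ⟩
    + 0                                 ≡⟨ cong ℤ.-_ (ℤ.*-zeroʳ (sgn (n ∸ suc k))) ⟨
    ℤ.- (sgn (n ∸ suc k) ℤ.* + 0)       ≡⟨ cong (λ c → ℤ.- (sgn (n ∸ suc k) ℤ.* + c)) nC[1+k]≡0 ⟨
    ℤ.- signedBinomial n (suc k)        ∎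
    where
    nC[1+k]≡0 : n C suc k ≡ 0
    nC[1+k]≡0 = k>n⇒nCk≡0 (s≤s (ℕ.≮⇒≥ k≮n))

∑< : ℕ → (ℕ → ℤ) → ℤ
∑< zero    f = + 0
∑< (suc L) f = f 0 ℤ.+ ∑< L (f ∘ suc)

syntax ∑< L (λ k → e) = ∑[ k < L ] e

∑<-cong : ∀ L {f g : ℕ → ℤ} → (∀ k → f k ≡ g k) → ∑< L f ≡ ∑< L g
∑<-cong zero    f≗g = refl
∑<-cong (suc L) f≗g = cong₂ ℤ._+_ (f≗g 0) (∑<-cong L (f≗g ∘ suc))

∑<-zero : ∀ L {f : ℕ → ℤ} → (∀ k → f k ≡ + 0) → ∑< L f ≡ + 0
∑<-zero zero    f≗0 = refl
∑<-zero (suc L) f≗0 = cong₂ ℤ._+_ (f≗0 0) (∑<-zero L (f≗0 ∘ suc))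

∑<-distrib-- : ∀ L (f g : ℕ → ℤ) → ∑[ k < L ] (f k ℤ.- g k) ≡ ∑< L f ℤ.- ∑< L g
∑<-distrib-- zero    f g = refl
∑<-distrib-- (suc L) f g = begin
  (f 0 ℤ.- g 0) ℤ.+ ∑[ k < L ] (f (suc k) ℤ.- g (suc k))
    ≡⟨ cong (ℤ._+_ (f 0 ℤ.- g 0)) (∑<-distrib-- L (f ∘ suc) (g ∘ suc)) ⟩
  (f 0 ℤ.- g 0) ℤ.+ (∑< L (f ∘ suc) ℤ.- ∑< L (g ∘ suc))
    ≡⟨ regroup (f 0) (g 0) _ _ ⟩
  (f 0 ℤ.+ ∑< L (f ∘ suc)) ℤ.- (g 0 ℤ.+ ∑< L (g ∘ suc)) ∎
  where
  regroup : ∀ a b c d → (a ℤ.- b) ℤ.+ (c ℤ.- d) ≡ (a ℤ.+ c) ℤ.- (b ℤ.+ d)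
  regroup = ℤ-Solver.solve-∀

foldr-map-applyUpTo : ∀ (g : ℕ → ℤ) f L → foldr ℤ._+_ (+ 0) (map g (applyUpTo f L)) ≡ ∑< L (g ∘ f)
foldr-map-applyUpTo g f zero    = refl
foldr-map-applyUpTo g f (suc L) = cong (ℤ._+_ (g (f 0))) (foldr-map-applyUpTo g (f ∘ suc) L)

-- fdiff n f is (Δⁿ f)(0) for the forward difference (Δ f)(m) = f (m + 1) − f m.
fdiff : ℕ → (ℕ → ℤ) → ℤ
fdiff zero    f = f 0
fdiff (suc n) f = fdiff n (f ∘ suc) ℤ.- fdiff n f

fdiff-cong : ∀ n {f g : ℕ → ℤ} → (∀ m → f m ≡ g m) → fdiff n f ≡ fdiff n g
fdiff-cong zero    f≗g = f≗g 0
fdiff-cong (suc n) f≗g = cong₂ ℤ._-_ (fdiff-cong n (f≗g ∘ suc)) (fdiff-cong n f≗g)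

fdiff-+ : ∀ n (f g : ℕ → ℤ) → fdiff n (λ m → f m ℤ.+ g m) ≡ fdiff n f ℤ.+ fdiff n g
fdiff-+ zero    f g = refl
fdiff-+ (suc n) f g = trans (cong₂ ℤ._-_ (fdiff-+ n (f ∘ suc) (g ∘ suc)) (fdiff-+ n f g))
                            (regroup (fdiff n (f ∘ suc)) (fdiff n (g ∘ suc)) (fdiff n f) (fdiff n g))
  where
  regroup : ∀ a b c d → (a ℤ.+ b) ℤ.- (c ℤ.+ d) ≡ (a ℤ.- c) ℤ.+ (b ℤ.- d)
  regroup = ℤ-Solver.solve-∀

fdiff-zero : ∀ n → fdiff n (λ _ → + 0) ≡ + 0
fdiff-zero zero    = refl
fdiff-zero (suc n) = cong₂ ℤ._-_ (fdiff-zero n) (fdiff-zero n)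

-- Newton's formula; the summation range L is arbitrary beyond n, as the extra terms vanish.
fdiff≡∑ : ∀ n L f → n < L → fdiff n f ≡ ∑[ k < L ] (signedBinomial n k ℤ.* f k)
fdiff≡∑ zero    (suc L) f _ = sym (begin
  + 1 ℤ.* f 0 ℤ.+ ∑[ k < L ] (+ 0 ℤ.* f (suc k))
    ≡⟨ cong₂ ℤ._+_ (ℤ.*-identityˡ (f 0)) (∑<-zero L (λ _ → refl)) ⟩
  f 0 ℤ.+ + 0
    ≡⟨ ℤ.+-identityʳ (f 0) ⟩
  f 0 ∎)
fdiff≡∑ (suc n) (suc L) f (s≤s n<L) = begin
  fdiff n (f ∘ suc) ℤ.- fdiff n f
    ≡⟨ cong₂ ℤ._-_ (fdiff≡∑ n L (f ∘ suc) n<L) (fdiff≡∑ n (suc L) f (ℕ.m<n⇒m<1+n n<L)) ⟩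
  A ℤ.- (s n 0 ℤ.* f 0 ℤ.+ B)
    ≡⟨ regroup (s n 0) (f 0) A B ⟩
  ℤ.- s n 0 ℤ.* f 0 ℤ.+ (A ℤ.- B)
    ≡⟨ cong₂ ℤ._+_ (cong (ℤ._* f 0) (signedBinomial-suc-zero n)) (∑<-distrib-- L _ _) ⟨
  s (suc n) 0 ℤ.* f 0 ℤ.+ ∑[ k < L ] (s n k ℤ.* f (suc k) ℤ.- s n (suc k) ℤ.* f (suc k))
    ≡⟨ cong (ℤ._+_ (s (suc n) 0 ℤ.* f 0)) (∑<-cong L pascal-term) ⟨
  s (suc n) 0 ℤ.* f 0 ℤ.+ ∑[ k < L ] (s (suc n) (suc k) ℤ.* f (suc k)) ∎
  where
  s = signedBinomial
  A = ∑[ k < L ] (s n k ℤ.* f (suc k))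
  B = ∑[ k < L ] (s n (suc k) ℤ.* f (suc k))
  regroup : ∀ c x a b → a ℤ.- (c ℤ.* x ℤ.+ b) ≡ ℤ.- c ℤ.* x ℤ.+ (a ℤ.- b)
  regroup = ℤ-Solver.solve-∀
  pascal-term : ∀ k → s (suc n) (suc k) ℤ.* f (suc k) ≡ s n k ℤ.* f (suc k) ℤ.- s n (suc k) ℤ.* f (suc k)
  pascal-term k = trans (cong (ℤ._* f (suc k)) (signedBinomial-suc-suc n k))
                        (distrib (s n k) (s n (suc k)) (f (suc k)))
    where
    distrib : ∀ a b x → (a ℤ.- b) ℤ.* x ≡ a ℤ.* x ℤ.- b ℤ.* x
    distrib = ℤ-Solver.solve-∀

riordan≡fdiff : ∀ n → riordan n ≡ fdiff n (λ k → + catalan k)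
riordan≡fdiff n = begin
  riordan n
    ≡⟨ foldr-map-applyUpTo (λ k → sgn (n ∸ k) ℤ.* + ((n C k) * catalan k)) (λ k → k) (suc n) ⟩
  ∑[ k < suc n ] (sgn (n ∸ k) ℤ.* + ((n C k) * catalan k))
    ≡⟨ ∑<-cong (suc n) term ⟩
  ∑[ k < suc n ] (signedBinomial n k ℤ.* + catalan k)
    ≡⟨ fdiff≡∑ n (suc n) (λ k → + catalan k) (ℕ.n<1+n n) ⟨
  fdiff n (λ k → + catalan k) ∎
  where
  term : ∀ k → sgn (n ∸ k) ℤ.* + ((n C k) * catalan k) ≡ signedBinomial n k ℤ.* + catalan k
  term k = trans (cong (sgn (n ∸ k) ℤ.*_) (ℤ.pos-* (n C k) (catalan k)))
                 (sym (ℤ.*-assoc (sgn (n ∸ k)) (+ (n C k)) (+ catalan k)))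

Admissible : ℕ → ℕ → List Step → Set
Admissible h u p = StaysAndEnds h p × NoDD p × NoD1 p × ups p ≡ u

NoLeadingDown : List Step → Set
NoLeadingDown []        = ⊤
NoLeadingDown (U ∷ _)   = ⊤
NoLeadingDown (D _ ∷ _) = ⊥

NoDD-D⁻ : ∀ {k} t → NoDD (D k ∷ t) → NoDD t × NoLeadingDown t
NoDD-D⁻ []      _   = tt , tt
NoDD-D⁻ (U ∷ _) ndd = ndd , tt

NoDD-D⁺ : ∀ {k} t → NoDD t → NoLeadingDown t → NoDD (D k ∷ t)
NoDD-D⁺ []      _   _ = tt
NoDD-D⁺ (U ∷ _) ndd _ = ndd

-- A fall from height g + 2 lands at 0 or is a fall from g + 1, lifted by one level.
falls : (ℕ → List (List Step)) → ℕ → List (List Step)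
falls r zero          = []
falls r (suc zero)    = []
falls r (suc (suc g)) = map (D (suc g) ∷_) (r 0) ++ falls (r ∘ suc) (suc g)

data Fall (r : ℕ → List (List Step)) : ℕ → List Step → Set where
  fall : ∀ j k {t} → t ∈ r j → Fall r (suc (suc (j + k))) (D (suc k) ∷ t)

∈-falls⁺ : ∀ {r h p} → Fall r h p → p ∈ falls r h
∈-falls⁺     (fall zero    k t∈r0) = ∈-++⁺ˡ (∈-map⁺ (D (suc k) ∷_) t∈r0)
∈-falls⁺ {r} (fall (suc j) k t∈rj) =
  ∈-++⁺ʳ (map (D (suc (suc (j + k))) ∷_) (r 0)) (∈-falls⁺ {r ∘ suc} (fall j k t∈rj))

∈-falls⁻ : ∀ {r} h {p} → p ∈ falls r h → Fall r h p
∈-falls⁻ {r} (suc (suc g)) {p} p∈ = [ from-head , shift ∘ ∈-falls⁻ (suc g) ]′ (∈-++⁻ _ p∈)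
  where
  from-head : p ∈ map (D (suc g) ∷_) (r 0) → Fall r (suc (suc g)) p
  from-head p∈map with ∈-map⁻ (D (suc g) ∷_) p∈map
  ... | t , t∈r0 , refl = fall 0 g t∈r0
  shift : ∀ {h} → Fall (r ∘ suc) h p → Fall r (suc h) p
  shift (fall j k t∈rj) = fall (suc j) k t∈rj

D-injective : ∀ {m n} → D m ≡ D n → m ≡ n
D-injective refl = refl

falls-unique : ∀ {r} → (∀ j → Unique (r j)) → ∀ h → Unique (falls r h)
falls-unique r! zero          = AllPairs.[]
falls-unique r! (suc zero)    = AllPairs.[]
falls-unique {r} r! (suc (suc g)) =
  ++⁺ (map⁺ ∷-injectiveʳ (r! 0)) (falls-unique (r! ∘ suc) (suc g)) disjoint
  where
  disjoint : ∀ {p} → ¬ (p ∈ map (D (suc g) ∷_) (r 0) × p ∈ falls (r ∘ suc) (suc g))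
  disjoint (p∈map , p∈falls) with ∈-falls⁻ {r ∘ suc} (suc g) p∈falls | ∈-map⁻ (D (suc g) ∷_) p∈map
  ... | fall j k _ | _ , _ , eq = ℕ.m≢1+n+m k (ℕ.suc-injective (D-injective (∷-injectiveˡ eq)))

length-falls : ∀ {r} (φ : ℕ → ℤ) → (∀ j → + length (r j) ≡ φ (suc j) ℤ.- φ j) →
               ∀ h → + length (falls r h) ≡ φ (h ∸ 1) ℤ.- φ 0
length-falls φ _ zero       = sym (ℤ.+-inverseʳ (φ 0))
length-falls φ _ (suc zero) = sym (ℤ.+-inverseʳ (φ 0))
length-falls {r} φ len-r (suc (suc g)) = begin
  + length (map (D (suc g) ∷_) (r 0) ++ falls (r ∘ suc) (suc g))
    ≡⟨ cong +_ (length-++ (map (D (suc g) ∷_) (r 0))) ⟩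
  + (length (map (D (suc g) ∷_) (r 0)) + length (falls (r ∘ suc) (suc g)))
    ≡⟨ cong (λ l → + (l + length (falls (r ∘ suc) (suc g)))) (length-map (D (suc g) ∷_) (r 0)) ⟩
  + (length (r 0) + length (falls (r ∘ suc) (suc g)))
    ≡⟨ ℤ.pos-+ (length (r 0)) _ ⟩
  + length (r 0) ℤ.+ + length (falls (r ∘ suc) (suc g))
    ≡⟨ cong₂ ℤ._+_ (len-r 0) (length-falls (φ ∘ suc) (len-r ∘ suc) (suc g)) ⟩
  (φ 1 ℤ.- φ 0) ℤ.+ (φ (suc g) ℤ.- φ 1)
    ≡⟨ telescope (φ 0) (φ 1) (φ (suc g)) ⟩
  φ (suc g) ℤ.- φ 0 ∎
  where
  telescope : ∀ a b c → (b ℤ.- a) ℤ.+ (c ℤ.- b) ≡ c ℤ.- a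
  telescope = ℤ-Solver.solve-∀

Fall⇒Admissible : ∀ {r u h p} → (∀ {j t} → t ∈ r j → Admissible j u t × NoLeadingDown t) →
                  Fall r h p → Admissible h u p
Fall⇒Admissible r-sound (fall j k {t} t∈rj) with r-sound t∈rj
... | (stays , ndd , nd1 , ups≡u) , nld =
  (s≤s (s≤s (ℕ.m≤n+m k j)) , subst (λ h → StaysAndEnds h t) (sym (ℕ.m+n∸n≡m j k)) stays) ,
  NoDD-D⁺ t ndd nld , nd1 , ups≡u

Admissible⇒Fall : ∀ {r u h k t} → (∀ {j t} → Admissible j u t → NoLeadingDown t → t ∈ r j) →
                  Admissible h u (D k ∷ t) → Fall r h (D k ∷ t)
Admissible⇒Fall {k = zero}  _ (_ , _ , () , _)
Admissible⇒Fall {r} {h = h} {suc k} {t} r-complete ((2+k≤h , stays) , ndd , nd1 , ups≡u) =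
  subst (λ h → Fall r h (D (suc k) ∷ t)) height
        (fall j k (r-complete (stays , proj₁ (NoDD-D⁻ t ndd) , nd1 , ups≡u) (proj₂ (NoDD-D⁻ t ndd))))
  where
  j = h ∸ suc (suc k)
  height : suc (suc (j + k)) ≡ h
  height = trans (sym (trans (ℕ.+-suc j (suc k)) (cong suc (ℕ.+-suc j k)))) (ℕ.m∸n+n≡m 2+k≤h)

rising : ℕ → ℕ → List (List Step)
rising h       (suc u) = map (U ∷_) (rising (suc h) u ++ falls (λ j → rising j u) (suc h))
rising zero    zero    = [] ∷ []
rising (suc h) zero    = []

admissible : ℕ → ℕ → List (List Step)
admissible h u = rising h u ++ falls (λ j → rising j u) h

rising-sound : ∀ u {h p} → p ∈ rising h u → Admissible h u p × NoLeadingDown p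
admissible-sound : ∀ u {h p} → p ∈ admissible h u → Admissible h u p

rising-sound zero    {zero} (here refl) = (refl , tt , tt , refl) , tt
rising-sound (suc u) {h}    p∈ with ∈-map⁻ (U ∷_) p∈
... | t , t∈ , refl with admissible-sound u {suc h} t∈
...   | stays , ndd , nd1 , ups≡u = (stays , ndd , nd1 , cong suc ups≡u) , tt

admissible-sound u {h} p∈ =
  [ proj₁ ∘ rising-sound u , Fall⇒Admissible (rising-sound u) ∘ ∈-falls⁻ h ]′ (∈-++⁻ (rising h u) p∈)

rising-complete : ∀ {h u} p → Admissible h u p → NoLeadingDown p → p ∈ rising h u
admissible-complete : ∀ {h u} p → Admissible h u p → p ∈ admissible h u

rising-complete []      (refl , _ , _ , refl) _ = here refl
rising-complete (U ∷ t) (stays , ndd , nd1 , refl) _ =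
  ∈-map⁺ (U ∷_) (admissible-complete t (stays , ndd , nd1 , refl))

admissible-complete []        adm = ∈-++⁺ˡ (rising-complete [] adm tt)
admissible-complete (U ∷ t)   adm = ∈-++⁺ˡ (rising-complete (U ∷ t) adm tt)
admissible-complete {h} {u} (D k ∷ t) adm =
  ∈-++⁺ʳ (rising h u) (∈-falls⁺ (Admissible⇒Fall (rising-complete _) adm))

rising-unique : ∀ h u → Unique (rising h u)
admissible-unique : ∀ h u → Unique (admissible h u)

rising-unique zero    zero    = All.[] AllPairs.∷ AllPairs.[]
rising-unique (suc h) zero    = AllPairs.[]
rising-unique h       (suc u) = map⁺ ∷-injectiveʳ (admissible-unique (suc h) u)

admissible-unique h u = ++⁺ (rising-unique h u) (falls-unique (λ j → rising-unique j u) h) disjoint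
  where
  disjoint : ∀ {p} → ¬ (p ∈ rising h u × p ∈ falls (λ j → rising j u) h)
  disjoint (p∈rising , p∈falls) with ∈-falls⁻ h p∈falls | proj₂ (rising-sound u p∈rising)
  ... | fall _ _ _ | ()

-- ballot shifted up one level, so that ballot₋₁-suc also holds at height 0.
ballot₋₁ : ℕ → ℕ → ℤ
ballot₋₁ zero    m = + 0
ballot₋₁ (suc h) m = + ballot h m

ballot₋₁-suc : ∀ h m → ballot₋₁ (suc h) (suc m) ≡ ballot₋₁ (suc (suc h)) m ℤ.+ ballot₋₁ h (suc m)
ballot₋₁-suc zero    m = sym (ℤ.+-identityʳ (+ ballot 1 m))
ballot₋₁-suc (suc h) m = ℤ.pos-+ (ballot (suc (suc h)) m) (ballot h (suc m))

fdiff-ballot₋₁-suc : ∀ u h →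
  fdiff (suc u) (ballot₋₁ (suc h)) ℤ.- fdiff (suc u) (ballot₋₁ h) ≡
  (fdiff u (ballot₋₁ (suc (suc h))) ℤ.- fdiff u (ballot₋₁ (suc h))) ℤ.+ fdiff u (ballot₋₁ h)
fdiff-ballot₋₁-suc u h = begin
  (fdiff u (ballot₋₁ (suc h) ∘ suc) ℤ.- b₁) ℤ.- (fdiff u (ballot₋₁ h ∘ suc) ℤ.- b₀)
    ≡⟨ cong (λ x → (x ℤ.- b₁) ℤ.- (fdiff u (ballot₋₁ h ∘ suc) ℤ.- b₀))
            (trans (fdiff-cong u (ballot₋₁-suc h)) (fdiff-+ u (ballot₋₁ (suc (suc h))) (ballot₋₁ h ∘ suc))) ⟩
  ((b₂ ℤ.+ fdiff u (ballot₋₁ h ∘ suc)) ℤ.- b₁) ℤ.- (fdiff u (ballot₋₁ h ∘ suc) ℤ.- b₀)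
    ≡⟨ regroup b₀ b₁ b₂ (fdiff u (ballot₋₁ h ∘ suc)) ⟩
  (b₂ ℤ.- b₁) ℤ.+ b₀ ∎
  where
  b₀ = fdiff u (ballot₋₁ h)
  b₁ = fdiff u (ballot₋₁ (suc h))
  b₂ = fdiff u (ballot₋₁ (suc (suc h)))
  regroup : ∀ b₀ b₁ b₂ x → ((b₂ ℤ.+ x) ℤ.- b₁) ℤ.- (x ℤ.- b₀) ≡ (b₂ ℤ.- b₁) ℤ.+ b₀
  regroup = ℤ-Solver.solve-∀

length-rising : ∀ u h →
  + length (rising h u) ≡ fdiff u (ballot₋₁ (suc h)) ℤ.- fdiff u (ballot₋₁ h)
length-admissible : ∀ u h →
  + length (admissible h u) ≡ (fdiff u (ballot₋₁ (suc h)) ℤ.- fdiff u (ballot₋₁ h)) ℤ.+ fdiff u (ballot₋₁ (h ∸ 1))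

length-rising (suc u) h = begin
  + length (map (U ∷_) (admissible (suc h) u))  ≡⟨ cong +_ (length-map (U ∷_) (admissible (suc h) u)) ⟩
  + length (admissible (suc h) u)               ≡⟨ length-admissible u (suc h) ⟩
  (F (suc (suc h)) ℤ.- F (suc h)) ℤ.+ F h       ≡⟨ fdiff-ballot₋₁-suc u h ⟨
  fdiff (suc u) (ballot₋₁ (suc h)) ℤ.- fdiff (suc u) (ballot₋₁ h) ∎
  where
  F = λ j → fdiff u (ballot₋₁ j)
length-rising zero zero    = refl
length-rising zero (suc h) = refl

length-admissible u h = begin
  + length (rising h u ++ falls (λ j → rising j u) h)
    ≡⟨ cong +_ (length-++ (rising h u)) ⟩
  + (length (rising h u) + length (falls (λ j → rising j u) h))
    ≡⟨ ℤ.pos-+ (length (rising h u)) _ ⟩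
  + length (rising h u) ℤ.+ + length (falls (λ j → rising j u) h)
    ≡⟨ cong₂ ℤ._+_ (length-rising u h) (length-falls F (length-rising u) h) ⟩
  (F (suc h) ℤ.- F h) ℤ.+ (F (h ∸ 1) ℤ.- F 0)
    ≡⟨ cong (λ z → (F (suc h) ℤ.- F h) ℤ.+ (F (h ∸ 1) ℤ.- z)) (fdiff-zero u) ⟩
  (F (suc h) ℤ.- F h) ℤ.+ (F (h ∸ 1) ℤ.- + 0)
    ≡⟨ cong (ℤ._+_ (F (suc h) ℤ.- F h)) (ℤ.+-identityʳ (F (h ∸ 1))) ⟩
  (F (suc h) ℤ.- F h) ℤ.+ F (h ∸ 1) ∎
  where
  F = λ j → fdiff u (ballot₋₁ j)

riordan-count : ∀ n → + length (admissible 0 n) ≡ riordan n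
riordan-count n = begin
  + length (admissible 0 n)               ≡⟨ length-admissible n 0 ⟩
  (fdiff n (ballot₋₁ 1) ℤ.- F₀) ℤ.+ F₀    ≡⟨ cancel (fdiff n (ballot₋₁ 1)) F₀ ⟩
  fdiff n (λ k → + ballot 0 k)            ≡⟨ fdiff-cong n (λ k → cong +_ (catalan≡ballot k)) ⟨
  fdiff n (λ k → + catalan k)             ≡⟨ riordan≡fdiff n ⟨
  riordan n                               ∎
  where
  F₀ = fdiff n (ballot₋₁ 0)
  cancel : ∀ a b → (a ℤ.- b) ℤ.+ b ≡ a
  cancel = ℤ-Solver.solve-∀

corollary2 : (n : ℕ) → n ≥ 1 →
    ∃ λ m → HasCount (λ (p : List Step) → IsDAP p × ups p ≡ n × NoD1 p) m × + m ≡ riordan n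
corollary2 n n≥1 =
  length (admissible 0 n) , (admissible 0 n , admissible-unique 0 n , ∈-DAPs , refl) , riordan-count n
  where
  nonEmpty : ∀ p → 1 ≤ ups p → NonEmpty p
  nonEmpty (_ ∷ _) _ = tt

  ∈-DAPs : ∀ p → p ∈ admissible 0 n ⇔ (IsDAP p × ups p ≡ n × NoD1 p)
  ∈-DAPs p = mk⇔ (to ∘ admissible-sound n) (admissible-complete p ∘ from)
    where
    to : Admissible 0 n p → IsDAP p × ups p ≡ n × NoD1 p
    to (stays , ndd , nd1 , ups≡n) =
      (nonEmpty p (subst (1 ≤_) (sym ups≡n) n≥1) , stays , ndd) , ups≡n , nd1
    from : IsDAP p × ups p ≡ n × NoD1 p → Admissible 0 n p
    from ((_ , stays , ndd) , ups≡n , nd1) = stays , ndd , nd1 , ups≡n
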